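{- Let $G$ be a multigraph. If $L^*(G)$ has a partially reflexive stable cut, then $G$ has a multigraph matching cut. If $G$ has a multigraph matching cut and every vertex of $G$ is incident to at least $2$ edges, then $L^*(G)$ has a partially reflexive stable cut.
   Context: A multigraph is a finite loopless graph in which parallel edges are allowed; $G_s$ denotes its underlying simple graph (each set of parallel edges replaced by one edge). A multigraph matching cut of $G$ is a partition of $V(G)$ into two nonempty sets $A,B$ such that every vertex is incident to at most one edge (edges counted with multiplicity) joining $A$ and $B$. For a simple graph $F$, its line graph $L(F)$ has a vertex for each edge of $F$, two being adjacent iff the edges share an endpoint. $L^*(G)$ is the partially reflexive graph obtained from $L(G_s)$ by adding a self-loop to every vertex corresponding to an edge of multiplicity at least $2$ in $G$. A partially reflexive graph is a simple graph in which some vertices carry a loop (reflexive), the others being irreflexive; a partially reflexive stable cut is a set $C$ of irreflexive vertices, pairwise non-adjacent, whose removal disconnects the graph. -}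

module Defs where

open import Data.Nat using (ℕ; zero; suc; _+_; _≤_; _<_)
open import Data.Fin using (Fin) renaming (zero to fz; suc to fs; _<_ to _<ᶠ_)
open import Data.Bool using (Bool; true; false; if_then_else_; _xor_)
open import Data.Product using (Σ; _×_; _,_; ∃; proj₁; proj₂)
open import Data.Sum using (_⊎_)
open import Relation.Binary.PropositionalEquality using (_≡_)
open import Relation.Nullary using (¬_)

∑ : ∀ {n} → (Fin n → ℕ) → ℕ
∑ {zero}  f = 0
∑ {suc n} f = f fz + ∑ (λ i → f (fs i))

-- A finite loopless multigraph on vertex set Fin n:
-- mult u v = number of parallel edges between u and v.
record Multigraph : Set where
  field
    n        : ℕ
    mult     : Fin n → Fin n → ℕ
    sym      : ∀ u v → mult u v ≡ mult v u
    loopless : ∀ v → mult v v ≡ 0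
open Multigraph public

degree : (G : Multigraph) → Fin (n G) → ℕ
degree G v = ∑ (λ u → mult G v u)

crossDegree : (G : Multigraph) → (Fin (n G) → Bool) → Fin (n G) → ℕ
crossDegree G side v = ∑ (λ u → if side u xor side v then mult G v u else 0)

IsMatchingCut : (G : Multigraph) → (Fin (n G) → Bool) → Set
IsMatchingCut G side =
  (∃ λ a → side a ≡ true) × (∃ λ b → side b ≡ false) ×
  (∀ v → crossDegree G side v ≤ 1)

HasMatchingCut : Multigraph → Set
HasMatchingCut G = ∃ λ side → IsMatchingCut G side

-- L*(G): vertices are edges {i,j} of G_s, represented as i < j with
-- mult i j ≥ 1.

LVertex : Multigraph → Set
LVertex G = Σ (Fin (n G)) λ i → Σ (Fin (n G)) λ j → (i <ᶠ j) × (1 ≤ mult G i j)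

src tgt : (G : Multigraph) → LVertex G → Fin (n G)
src G e = proj₁ e
tgt G e = proj₁ (proj₂ e)

LAdj : (G : Multigraph) → LVertex G → LVertex G → Set
LAdj G e f =
  ¬ (src G e ≡ src G f × tgt G e ≡ tgt G f) ×
  (src G e ≡ src G f ⊎ src G e ≡ tgt G f ⊎ tgt G e ≡ src G f ⊎ tgt G e ≡ tgt G f)

LReflexive : (G : Multigraph) → LVertex G → Set
LReflexive G e = 2 ≤ mult G (src G e) (tgt G e)

data ReachAvoiding (G : Multigraph) (C : LVertex G → Set) :
       LVertex G → LVertex G → Set where
  here : ∀ {e} → ¬ C e → ReachAvoiding G C e e
  step : ∀ {e f g} → ¬ C e → LAdj G e f →
         ReachAvoiding G C f g → ReachAvoiding G C e g

IsPRStableCut : (G : Multigraph) → (LVertex G → Set) → Set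
IsPRStableCut G C =
  (∀ e → C e → ¬ LReflexive G e) ×
  (∀ e f → C e → C f → ¬ LAdj G e f) ×
  (∃ λ e → ∃ λ f → ¬ C e × ¬ C f × ¬ ReachAvoiding G C e f)

HasPRStableCut : Multigraph → Set₁
HasPRStableCut G = ∃ λ (C : LVertex G → Set) → IsPRStableCut G C

{-# OPTIONS --safe #-}
-- Given a stable cut C separating e₀ from f₀ in L*(G), let A be the set of vertices reachable
-- from an endpoint of e₀ along edges outside C. Every edge leaving A lies in C, so it is simple,
-- and two of them at one vertex would be adjacent in L*(G); hence (A, V − A) is a matching cut,
-- and the endpoints of f₀ lie outside A.
-- Conversely, the crossing edges of a matching cut form a stable cut: a reflexive crossing edge,
-- or two adjacent ones, would give some vertex two crossing edges, and a walk in L*(G) − C never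
-- changes side. Since every vertex has degree ≥ 2 but at most one crossing edge, both sides
-- contain an edge outside C.
module Submission where

open import Defs
open import Data.Nat using (_≤_)
open import Data.Product using (_×_)

open import Data.Bool using (Bool; true; false; _xor_; if_then_else_)
open import Data.Bool.Properties using (¬-not; xor-same; xor-inverseˡ) renaming (_≟_ to _≟ᵇ_)
open import Data.Fin using (Fin; _≟_) renaming (zero to fz; suc to fs)
open import Data.Fin.Properties using (any?; all?; suc-injective; 0≢1+n; <-asym; <-cmp; <-irrelevant)
open import Data.Fin.Subset using (Subset)
open import Data.Fin.Subset.Properties using (anySubset?)
open import Data.Nat using (ℕ; zero; suc; _+_; _<_; _<?_; _≤?_; z≤n; s≤s; z<s)
open import Data.Nat.Properties
  using (≤-trans; ≤-reflexive; ≤-irrelevant; m≤m+n; m≤n+m; +-comm; +-identityʳ; +-mono-≤; +-monoʳ-≤;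
         <⇒≤; <⇒≱; ≰⇒>; ≮⇒≥; <-irrefl; ≤-<-trans; 1+n≰n; n≤0⇒n≡0; module ≤-Reasoning)
open import Data.Product using (Σ; ∃; _,_; map)
open import Data.Sum using (_⊎_; inj₁; inj₂)
open import Data.Vec using (lookup; tabulate)
open import Data.Vec.Properties using (lookup∘tabulate)
open import Function using (_∘_; id)
open import Relation.Binary using (tri<; tri≈; tri>)
open import Relation.Binary.PropositionalEquality as ≡
  using (_≡_; _≢_; refl; cong; cong₂; subst; ≢-sym; module ≡-Reasoning)
open import Relation.Nullary using (¬_; Dec; yes; no; does; proof; contradiction)
open import Relation.Nullary.Decidable using (_×-dec_; decidable-stable; ¬¬-excluded-middle)
open import Relation.Nullary.Negation using (¬¬-map)
open import Relation.Nullary.Reflects using (Reflects; ofʸ; ofⁿ; det)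

f≤∑f : ∀ {m} (f : Fin m → ℕ) (i : Fin m) → f i ≤ ∑ f
f≤∑f f fz     = m≤m+n _ _
f≤∑f f (fs i) = ≤-trans (f≤∑f (f ∘ fs) i) (m≤n+m _ _)

f+f≤∑f : ∀ {m} (f : Fin m → ℕ) {i j : Fin m} → i ≢ j → f i + f j ≤ ∑ f
f+f≤∑f f {fz}   {fz}   i≢j = contradiction refl i≢j
f+f≤∑f f {fz}   {fs j} _   = +-monoʳ-≤ (f fz) (f≤∑f (f ∘ fs) j)
f+f≤∑f f {fs i} {fz}   _   =
  ≤-trans (≤-reflexive (+-comm (f (fs i)) (f fz))) (+-monoʳ-≤ (f fz) (f≤∑f (f ∘ fs) i))
f+f≤∑f f {fs i} {fs j} i≢j = ≤-trans (f+f≤∑f (f ∘ fs) (i≢j ∘ cong fs)) (m≤n+m _ _)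

∑-zero : ∀ {m} (f : Fin m → ℕ) → (∀ i → f i ≡ 0) → ∑ f ≡ 0
∑-zero {zero}  f f≡0 = refl
∑-zero {suc m} f f≡0 rewrite f≡0 fz = ∑-zero (f ∘ fs) (f≡0 ∘ fs)

∑≤1⇒unique-support : ∀ {m} {f : Fin m → ℕ} → ∑ f ≤ 1 → ∀ {i j} → 0 < f i → 0 < f j → i ≡ j
∑≤1⇒unique-support {f = f} ∑≤1 {i} {j} pos pos′ with i ≟ j
... | yes i≡j = i≡j
... | no i≢j  = contradiction (≤-trans (+-mono-≤ pos pos′) (≤-trans (f+f≤∑f f i≢j) ∑≤1)) 1+n≰n

unique-support⇒∑≤1 : ∀ {m} {f : Fin m → ℕ} → (∀ i → f i ≤ 1) →
                     (∀ {i j} → 0 < f i → 0 < f j → i ≡ j) → ∑ f ≤ 1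
unique-support⇒∑≤1 {zero}          _   _      = z≤n
unique-support⇒∑≤1 {suc m} {f} f≤1 unique with f fz in f₀≡
... | zero  = unique-support⇒∑≤1 (f≤1 ∘ fs) (λ pos pos′ → suc-injective (unique pos pos′))
... | suc k = begin
  suc k + ∑ (f ∘ fs) ≡⟨ cong (suc k +_) (∑-zero (f ∘ fs) rest≡0) ⟩
  suc k + 0          ≡⟨ +-identityʳ (suc k) ⟩
  suc k              ≡⟨ f₀≡ ⟨
  f fz               ≤⟨ f≤1 fz ⟩
  1                  ∎
  where
  open ≤-Reasoning
  rest≡0 : ∀ i → f (fs i) ≡ 0
  rest≡0 i = n≤0⇒n≡0 (≮⇒≥ λ pos → 0≢1+n (unique (subst (0 <_) (≡.sym f₀≡) z<s) pos))

∑<∑⇒∃< : ∀ {m} (f g : Fin m → ℕ) → ∑ f < ∑ g → ∃ λ i → f i < g i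
∑<∑⇒∃< {zero}  f g ()
∑<∑⇒∃< {suc m} f g ∑f<∑g with f fz <? g fz
... | yes f₀<g₀ = fz , f₀<g₀
... | no  f₀≮g₀ =
  map fs id (∑<∑⇒∃< (f ∘ fs) (g ∘ fs) (≰⇒> λ rest≥ → <⇒≱ ∑f<∑g (+-mono-≤ (≮⇒≥ f₀≮g₀) rest≥)))

¬¬-pull : ∀ {m} {P : Fin m → Set} → (∀ i → ¬ ¬ P i) → ¬ ¬ (∀ i → P i)
¬¬-pull {zero}  _     k = k λ ()
¬¬-pull {suc m} ¬¬P k = ¬¬P fz λ p₀ → ¬¬-pull (¬¬P ∘ fs) λ ps → k λ { fz → p₀ ; (fs i) → ps i }

¬¬-reflecting-subset : ∀ {m} (R : Fin m → Set) → ¬ ¬ ∃ λ (S : Subset m) → ∀ i → Reflects (R i) (lookup S i)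
¬¬-reflecting-subset R = ¬¬-map reflecting-subset (¬¬-pull λ _ → ¬¬-excluded-middle)
  where
  reflecting-subset : (∀ i → Dec (R i)) → ∃ λ (S : Subset _) → ∀ i → Reflects (R i) (lookup S i)
  reflecting-subset R? =
    tabulate (does ∘ R?) , λ i → subst (Reflects (R i)) (≡.sym (lookup∘tabulate (does ∘ R?) i)) (proof (R? i))

crossMult : (G : Multigraph) → (Fin (n G) → Bool) → Fin (n G) → Fin (n G) → ℕ
crossMult G side v u = if side u xor side v then mult G v u else 0

module _ (G : Multigraph) (side : Fin (n G) → Bool) {v u : Fin (n G)} where

  crossMult-≢ : side u ≢ side v → crossMult G side v u ≡ mult G v u
  crossMult-≢ u≢v rewrite ¬-not u≢v | xor-inverseˡ (side v) = refl

  crossMult-≡ : side u ≡ side v → crossMult G side v u ≡ 0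
  crossMult-≡ u≡v rewrite u≡v | xor-same (side v) = refl

  crossMult≤mult : crossMult G side v u ≤ mult G v u
  crossMult≤mult with side u ≟ᵇ side v
  ... | yes u≡v = subst (_≤ mult G v u) (≡.sym (crossMult-≡ u≡v)) z≤n
  ... | no  u≢v = ≤-reflexive (crossMult-≢ u≢v)

  positive-crossMult⇒≢ : 0 < crossMult G side v u → side u ≢ side v
  positive-crossMult⇒≢ pos u≡v = <-irrefl (≡.sym (crossMult-≡ u≡v)) pos

  crossMult<mult⇒≡ : crossMult G side v u < mult G v u → side u ≡ side v
  crossMult<mult⇒≡ lt = decidable-stable (side u ≟ᵇ side v) λ u≢v → <-irrefl (crossMult-≢ u≢v) lt

isMatchingCut? : (G : Multigraph) (side : Fin (n G) → Bool) → Dec (IsMatchingCut G side)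
isMatchingCut? G side =
  any? (λ a → side a ≟ᵇ true) ×-dec any? (λ b → side b ≟ᵇ false) ×-dec
  all? (λ v → crossDegree G side v ≤? 1)

module LineGraph (G : Multigraph) where

  data Joins (ℓ : LVertex G) (u v : Fin (n G)) : Set where
    forward  : src G ℓ ≡ u → tgt G ℓ ≡ v → Joins ℓ u v
    backward : src G ℓ ≡ v → tgt G ℓ ≡ u → Joins ℓ u v

  data Incident (ℓ : LVertex G) (w : Fin (n G)) : Set where
    at-src : src G ℓ ≡ w → Incident ℓ w
    at-tgt : tgt G ℓ ≡ w → Incident ℓ w

  LVertex-ext : ∀ ℓ ℓ′ → src G ℓ ≡ src G ℓ′ → tgt G ℓ ≡ tgt G ℓ′ → ℓ ≡ ℓ′
  LVertex-ext (i , j , i<j , m) (.i , .j , i<j′ , m′) refl refl =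
    cong₂ (λ p q → i , j , p , q) (<-irrelevant i<j i<j′) (≤-irrelevant m m′)

  Joins-sym : ∀ {ℓ u v} → Joins ℓ u v → Joins ℓ v u
  Joins-sym (forward s≡u t≡v)  = backward s≡u t≡v
  Joins-sym (backward s≡v t≡u) = forward s≡v t≡u

  Joins⇒Incident : ∀ {ℓ u v} → Joins ℓ u v → Incident ℓ u
  Joins⇒Incident (forward s≡u _)  = at-src s≡u
  Joins⇒Incident (backward _ t≡u) = at-tgt t≡u

  Incident⇒Joins : ∀ {ℓ w} → Incident ℓ w → ∃ (Joins ℓ w)
  Incident⇒Joins {ℓ} (at-src s≡w) = tgt G ℓ , forward s≡w refl
  Incident⇒Joins {ℓ} (at-tgt t≡w) = src G ℓ , backward refl t≡w

  Joins⇒mult≡ : ∀ {ℓ u v} → Joins ℓ u v → mult G u v ≡ mult G (src G ℓ) (tgt G ℓ)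
  Joins⇒mult≡         (forward refl refl)  = refl
  Joins⇒mult≡ {u = u} (backward refl refl) = sym G u _

  Joins⇒0<mult : ∀ {ℓ u v} → Joins ℓ u v → 0 < mult G u v
  Joins⇒0<mult {_ , _ , _ , 0<m} j = subst (0 <_) (≡.sym (Joins⇒mult≡ j)) 0<m

  lvertex : ∀ {u v} → 0 < mult G u v → Σ (LVertex G) λ ℓ → Joins ℓ u v
  lvertex {u} {v} 0<m with <-cmp u v
  ... | tri< u<v _ _ = (u , v , u<v , 0<m) , forward refl refl
  ... | tri≈ _ refl _ = contradiction (subst (0 <_) (loopless G u) 0<m) λ ()
  ... | tri> _ _ v<u = (v , u , v<u , subst (0 <_) (sym G u v) 0<m) , backward refl refl

  Joins-injective : ∀ {ℓ ℓ′ u v} → Joins ℓ u v → Joins ℓ′ u v → ℓ ≡ ℓ′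
  Joins-injective {_ , _ , _} {_ , _ , _} (forward refl refl)  (forward refl refl)  = LVertex-ext _ _ refl refl
  Joins-injective {_ , _ , _} {_ , _ , _} (backward refl refl) (backward refl refl) = LVertex-ext _ _ refl refl
  Joins-injective {_ , _ , i<j , _} {_ , _ , j<i , _} (forward refl refl)  (backward refl refl) =
    contradiction j<i (<-asym i<j)
  Joins-injective {_ , _ , i<j , _} {_ , _ , j<i , _} (backward refl refl) (forward refl refl)  =
    contradiction j<i (<-asym i<j)

  Joins-functional : ∀ {ℓ u v v′} → Joins ℓ u v → Joins ℓ u v′ → v ≡ v′
  Joins-functional {_ , _ , _} (forward refl refl)  (forward refl refl)  = refl
  Joins-functional {_ , _ , _} (forward refl refl)  (backward refl refl) = refl
  Joins-functional {_ , _ , _} (backward refl refl) (forward refl refl)  = refl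
  Joins-functional {_ , _ , _} (backward refl refl) (backward refl refl) = refl

  LAdj⇒common : ∀ {e f} → LAdj G e f → ∃ λ w → Incident e w × Incident f w
  LAdj⇒common {e} (_ , inj₁ s≡s)               = src G e , at-src refl , at-src (≡.sym s≡s)
  LAdj⇒common {e} (_ , inj₂ (inj₁ s≡t))        = src G e , at-src refl , at-tgt (≡.sym s≡t)
  LAdj⇒common {e} (_ , inj₂ (inj₂ (inj₁ t≡s))) = tgt G e , at-tgt refl , at-src (≡.sym t≡s)
  LAdj⇒common {e} (_ , inj₂ (inj₂ (inj₂ t≡t))) = tgt G e , at-tgt refl , at-tgt (≡.sym t≡t)

  common⇒≡⊎LAdj : ∀ {e f w} → Incident e w → Incident f w → e ≡ f ⊎ LAdj G e f
  common⇒≡⊎LAdj {e} {f} ie if with (src G e ≟ src G f) ×-dec (tgt G e ≟ tgt G f)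
  ... | yes (s≡s , t≡t) = inj₁ (LVertex-ext e f s≡s t≡t)
  ... | no  distinct    = inj₂ (distinct , shared ie if)
    where
    shared : ∀ {w} → Incident e w → Incident f w → _
    shared (at-src s≡w) (at-src s′≡w) = inj₁ (≡.trans s≡w (≡.sym s′≡w))
    shared (at-src s≡w) (at-tgt t′≡w) = inj₂ (inj₁ (≡.trans s≡w (≡.sym t′≡w)))
    shared (at-tgt t≡w) (at-src s′≡w) = inj₂ (inj₂ (inj₁ (≡.trans t≡w (≡.sym s′≡w))))
    shared (at-tgt t≡w) (at-tgt t′≡w) = inj₂ (inj₂ (inj₂ (≡.trans t≡w (≡.sym t′≡w))))

  LAdj⇒fork : ∀ {e f} → LAdj G e f →
              ∃ λ w → ∃ λ x → ∃ λ x′ → Joins e w x × Joins f w x′ × x ≢ x′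
  LAdj⇒fork {e} {f} adj@(distinct , _) =
    let w , ie , if = LAdj⇒common adj
        x , je = Incident⇒Joins ie
        x′ , jf = Incident⇒Joins if
    in w , x , x′ , je , jf , λ x≡x′ →
         let e≡f = Joins-injective je (subst (Joins f w) (≡.sym x≡x′) jf)
         in distinct (cong (src G) e≡f , cong (tgt G) e≡f)

  fork⇒LAdj : ∀ {e f w x x′} → Joins e w x → Joins f w x′ → x ≢ x′ → LAdj G e f
  fork⇒LAdj {w = w} {x′ = x′} je jf x≢x′ with common⇒≡⊎LAdj (Joins⇒Incident je) (Joins⇒Incident jf)
  ... | inj₁ e≡f = contradiction (Joins-functional je (subst (λ g → Joins g w x′) (≡.sym e≡f) jf)) x≢x′
  ... | inj₂ adj  = adj

  module _ {C : LVertex G → Set} where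

    ReachAvoiding-head : ∀ {e g} → ReachAvoiding G C e g → ¬ C e
    ReachAvoiding-head (here ¬Ce)     = ¬Ce
    ReachAvoiding-head (step ¬Ce _ _) = ¬Ce

    ReachAvoiding-snoc : ∀ {e h g} → ReachAvoiding G C e h → h ≡ g ⊎ LAdj G h g → ¬ C g → ReachAvoiding G C e g
    ReachAvoiding-snoc (here ¬Ch)        (inj₁ refl) _   = here ¬Ch
    ReachAvoiding-snoc (here ¬Ch)        (inj₂ adj)  ¬Cg = step ¬Ch adj (here ¬Cg)
    ReachAvoiding-snoc (step ¬Ce adj r) h≈g          ¬Cg = step ¬Ce adj (ReachAvoiding-snoc r h≈g ¬Cg)

module Reachability (G : Multigraph) (C : LVertex G → Set) (e₀ : LVertex G) where
  open LineGraph G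

  data Reachable : Fin (n G) → Set where
    start  : Reachable (src G e₀)
    extend : ∀ {u v} ℓ → Reachable u → Joins ℓ u v → ¬ C ℓ → Reachable v

  Reachable⇒ReachAvoiding : ¬ C e₀ → ∀ {v g} → Reachable v → Incident g v → ¬ C g → ReachAvoiding G C e₀ g
  Reachable⇒ReachAvoiding ¬Ce₀ start ig ¬Cg =
    ReachAvoiding-snoc (here ¬Ce₀) (common⇒≡⊎LAdj (at-src refl) ig) ¬Cg
  Reachable⇒ReachAvoiding ¬Ce₀ (extend ℓ r j ¬Cℓ) ig ¬Cg =
    ReachAvoiding-snoc (Reachable⇒ReachAvoiding ¬Ce₀ r (Joins⇒Incident j) ¬Cℓ)
                       (common⇒≡⊎LAdj (Joins⇒Incident (Joins-sym j)) ig) ¬Cg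

  module _ (irreflexive : ∀ e → C e → ¬ LReflexive G e) (independent : ∀ e f → C e → C f → ¬ LAdj G e f)
           (side : Fin (n G) → Bool) (side-reflects : ∀ v → Reflects (Reachable v) (side v)) where

    crossing⇒¬¬C : ∀ {ℓ u v} → Joins ℓ u v → side u ≢ side v → ¬ ¬ C ℓ
    crossing⇒¬¬C {ℓ} {u} {v} j u≢v ¬Cℓ with side u | side-reflects u | side v | side-reflects v
    ... | true  | ofʸ ru  | false | ofⁿ ¬rv = ¬rv (extend ℓ ru j ¬Cℓ)
    ... | false | ofⁿ ¬ru | true  | ofʸ rv  = ¬ru (extend ℓ rv (Joins-sym j) ¬Cℓ)
    ... | true  | _       | true  | _       = u≢v refl
    ... | false | _       | false | _       = u≢v refl

    positive-crossMult⇒¬¬C : ∀ {v u} → 0 < crossMult G side v u → Σ (LVertex G) λ ℓ → Joins ℓ v u × ¬ ¬ C ℓ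
    positive-crossMult⇒¬¬C pos =
      let ℓ , j = lvertex (≤-trans pos (crossMult≤mult G side))
      in ℓ , j , crossing⇒¬¬C j (≢-sym (positive-crossMult⇒≢ G side pos))

    crossMult≤1 : ∀ v u → crossMult G side v u ≤ 1
    crossMult≤1 v u = ≮⇒≥ λ 1<cm →
      let ℓ , j , ¬¬Cℓ = positive-crossMult⇒¬¬C (<⇒≤ 1<cm)
          reflexive = subst (1 <_) (Joins⇒mult≡ j) (≤-trans 1<cm (crossMult≤mult G side))
      in ¬¬Cℓ λ Cℓ → irreflexive ℓ Cℓ reflexive

    crossMult-unique-support : ∀ v {u u′} → 0 < crossMult G side v u → 0 < crossMult G side v u′ → u ≡ u′
    crossMult-unique-support v {u} {u′} pos pos′ = decidable-stable (u ≟ u′) λ u≢u′ →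
      let ℓ , j , ¬¬Cℓ = positive-crossMult⇒¬¬C pos
          ℓ′ , j′ , ¬¬Cℓ′ = positive-crossMult⇒¬¬C pos′
      in ¬¬Cℓ λ Cℓ → ¬¬Cℓ′ λ Cℓ′ → independent ℓ ℓ′ Cℓ Cℓ′ (fork⇒LAdj j j′ u≢u′)

    reachable-side-isMatchingCut : ¬ C e₀ → ∀ f₀ → ¬ C f₀ → ¬ ReachAvoiding G C e₀ f₀ → IsMatchingCut G side
    reachable-side-isMatchingCut ¬Ce₀ f₀ ¬Cf₀ unreachable =
      (src G e₀ , det (side-reflects _) (ofʸ start)) ,
      (src G f₀ , det (side-reflects _)
                    (ofⁿ λ r → unreachable (Reachable⇒ReachAvoiding ¬Ce₀ r (at-src refl) ¬Cf₀))) ,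
      λ v → unique-support⇒∑≤1 (crossMult≤1 v) (crossMult-unique-support v)

module CrossingEdges (G : Multigraph) (side : Fin (n G) → Bool)
                     (crossDegree≤1 : ∀ v → crossDegree G side v ≤ 1) where
  open LineGraph G

  Crossing : LVertex G → Set
  Crossing ℓ = side (src G ℓ) ≢ side (tgt G ℓ)

  Crossing-Joins : ∀ {ℓ u v} → Crossing ℓ → Joins ℓ u v → side u ≢ side v
  Crossing-Joins c (forward refl refl)  = c
  Crossing-Joins c (backward refl refl) = ≢-sym c

  crossing-irreflexive : ∀ ℓ → Crossing ℓ → ¬ LReflexive G ℓ
  crossing-irreflexive ℓ c 2≤m = 1+n≰n (begin
    2                                         ≤⟨ 2≤m ⟩
    mult G (src G ℓ) (tgt G ℓ)                ≡⟨ crossMult-≢ G side (≢-sym c) ⟨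
    crossMult G side (src G ℓ) (tgt G ℓ)      ≤⟨ f≤∑f _ (tgt G ℓ) ⟩
    crossDegree G side (src G ℓ)              ≤⟨ crossDegree≤1 (src G ℓ) ⟩
    1                                         ∎)
    where open ≤-Reasoning

  Crossing-Joins⇒0<crossMult : ∀ {ℓ w x} → Crossing ℓ → Joins ℓ w x → 0 < crossMult G side w x
  Crossing-Joins⇒0<crossMult c j =
    subst (0 <_) (≡.sym (crossMult-≢ G side (≢-sym (Crossing-Joins c j)))) (Joins⇒0<mult j)

  crossing-independent : ∀ e f → Crossing e → Crossing f → ¬ LAdj G e f
  crossing-independent e f ce cf adj =
    let w , x , x′ , je , jf , x≢x′ = LAdj⇒fork {e} {f} adj
    in x≢x′ (∑≤1⇒unique-support (crossDegree≤1 w)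
               (Crossing-Joins⇒0<crossMult ce je) (Crossing-Joins⇒0<crossMult cf jf))

  non-crossing-at : (∀ v → 2 ≤ degree G v) → ∀ w → Σ (LVertex G) λ ℓ → ¬ Crossing ℓ × Incident ℓ w
  non-crossing-at degree≥2 w =
    let u , cm<m = ∑<∑⇒∃< (crossMult G side w) (mult G w) (≤-trans (s≤s (crossDegree≤1 w)) (degree≥2 w))
        ℓ , j = lvertex (≤-<-trans z≤n cm<m)
    in ℓ , (λ c → Crossing-Joins c j (≡.sym (crossMult<mult⇒≡ G side cm<m))) , Joins⇒Incident j

  ¬Crossing-Incident : ∀ {ℓ w} → ¬ Crossing ℓ → Incident ℓ w → side w ≡ side (src G ℓ)
  ¬Crossing-Incident _  (at-src refl) = refl
  ¬Crossing-Incident ¬c (at-tgt refl) = ≡.sym (decidable-stable (_ ≟ᵇ _) ¬c)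

  ReachAvoiding-side : ∀ {e f} → ReachAvoiding G Crossing e f → side (src G e) ≡ side (src G f)
  ReachAvoiding-side (here _) = refl
  ReachAvoiding-side {e} {f} (step {f = g} ¬ce adj r) =
    let w , ie , ig = LAdj⇒common {e} {g} adj
    in begin
      side (src G e) ≡⟨ ¬Crossing-Incident ¬ce ie ⟨
      side w         ≡⟨ ¬Crossing-Incident (ReachAvoiding-head r) ig ⟩
      side (src G g) ≡⟨ ReachAvoiding-side r ⟩
      side (src G f) ∎
    where open ≡-Reasoning

-- Reachability avoiding an arbitrary predicate C is not decidable, so the side function
-- exists only under ¬¬; this suffices because matching cuts are decidable.
stableCut⇒matchingCut : ∀ (G : Multigraph) → HasPRStableCut G → HasMatchingCut G
stableCut⇒matchingCut G (C , irreflexive , independent , e₀ , f₀ , ¬Ce₀ , ¬Cf₀ , unreachable) =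
  map lookup id (decidable-stable (anySubset? (isMatchingCut? G ∘ lookup))
                                  (¬¬-map matchingCut (¬¬-reflecting-subset Reachable)))
  where
  open Reachability G C e₀
  matchingCut : (∃ λ S → ∀ v → Reflects (Reachable v) (lookup S v)) → ∃ λ S → IsMatchingCut G (lookup S)
  matchingCut (S , reflects) =
    S , reachable-side-isMatchingCut irreflexive independent (lookup S) reflects ¬Ce₀ f₀ ¬Cf₀ unreachable

matchingCut⇒stableCut : ∀ (G : Multigraph) → HasMatchingCut G → (∀ v → 2 ≤ degree G v) → HasPRStableCut G
matchingCut⇒stableCut G (side , (a , a∈A) , (b , b∈B) , crossDegree≤1) degree≥2 =
  let e , ¬ce , ie = non-crossing-at degree≥2 a
      f , ¬cf , if = non-crossing-at degree≥2 b
      separated : ¬ ReachAvoiding G Crossing e f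
      separated r = contradiction (begin
        true           ≡⟨ a∈A ⟨
        side a         ≡⟨ ¬Crossing-Incident ¬ce ie ⟩
        side (src G e) ≡⟨ ReachAvoiding-side r ⟩
        side (src G f) ≡⟨ ¬Crossing-Incident ¬cf if ⟨
        side b         ≡⟨ b∈B ⟩
        false          ∎) λ ()
  in Crossing , crossing-irreflexive , crossing-independent , e , f , ¬ce , ¬cf , separated
  where
  open CrossingEdges G side crossDegree≤1
  open ≡-Reasoning

corollary3 : (∀ (G : Multigraph) → HasPRStableCut G → HasMatchingCut G)
    × (∀ (G : Multigraph) → HasMatchingCut G → (∀ v → 2 ≤ degree G v) → HasPRStableCut G)
corollary3 = stableCut⇒matchingCut , matchingCut⇒stableCut
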